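{- Let $C(x,y)=\sum_{n,k\geq 0} c_{n,k}x^ny^k$, where $c_{n,k}$ is the number of Catalan words of length $n$ with exactly $k$ descents. Then $$C(x,y)=\frac{1-2x+2xy-\sqrt{1-4x+4x^2-4x^2y}}{2xy}.$$
   Context: A Catalan word of length $n\geq 1$ is a word $w_1w_2\ldots w_n$ over the non-negative integers with $w_1=0$ and $0\leq w_i\leq w_{i-1}+1$ for $i=2,\ldots,n$; the empty word is the unique Catalan word of length $0$. A descent of a word $w_1\ldots w_n$ is an index $i\in\{1,\ldots,n-1\}$ with $w_i>w_{i+1}$. Generating functions are formal power series in $x,y$. -}

module Defs where

open import Data.Nat as ℕ using (ℕ; zero; suc; _≤_; _≤?_; _<ᵇ_)
open import Data.Bool using (if_then_else_)
open import Data.Integer as ℤ using (ℤ; +_; -_)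
open import Data.List using (List; []; _∷_; length; filter; concatMap; map; upTo)
open import Data.List.Relation.Unary.Linked using (Linked; linked?)
open import Relation.Nullary using (Dec; yes; no; ¬_)
open import Relation.Nullary.Decidable using (map′; _×-dec_)
open import Relation.Binary.PropositionalEquality using (_≡_; refl)
open import Data.Product using (_×_; _,_; proj₁; proj₂)

Step : ℕ → ℕ → Set
Step a b = b ≤ suc a

step? : (a b : ℕ) → Dec (Step a b)
step? a b = b ≤? suc a

data IsCatalan : List ℕ → Set where
  empty    : IsCatalan []
  nonempty : ∀ {t} → Linked Step (0 ∷ t) → IsCatalan (0 ∷ t)

isCatalan? : (w : List ℕ) → Dec (IsCatalan w)
isCatalan? [] = yes empty
isCatalan? (zero ∷ t) = map′ nonempty (λ { (nonempty l) → l }) (linked? step? (0 ∷ t))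
isCatalan? (suc a ∷ t) = no (λ ())

des : List ℕ → ℕ
des (a ∷ b ∷ t) = (if b <ᵇ a then 1 else 0) ℕ.+ des (b ∷ t)
des _ = 0

words : ℕ → ℕ → List (List ℕ)
words zero b = [] ∷ []
words (suc n) b = concatMap (λ a → map (a ∷_) (words n b)) (upTo b)

-- c n k = number of Catalan words of length n with exactly k descents.
-- (Letters of a Catalan word of length n are ≤ n-1 < n, so words n n
-- contains every Catalan word of length n, each exactly once.)
c : ℕ → ℕ → ℕ
c n k = length (filter (λ w → isCatalan? w ×-dec (des w ℕ.≟ k)) (words n n))

PS : Set
PS = ℕ → ℕ → ℤ

sumTo : ℕ → (ℕ → ℤ) → ℤ
sumTo zero f = f 0
sumTo (suc n) f = sumTo n f ℤ.+ f (suc n)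

constPS : ℤ → PS
constPS a zero zero = a
constPS a _ _ = + 0

X : PS
X 1 0 = + 1
X _ _ = + 0

Y : PS
Y 0 1 = + 1
Y _ _ = + 0

infixl 6 _⊕_ _⊖_
infixl 7 _⊛_

_⊕_ : PS → PS → PS
(f ⊕ g) n k = f n k ℤ.+ g n k

_⊖_ : PS → PS → PS
(f ⊖ g) n k = f n k ℤ.- g n k

_⊛_ : PS → PS → PS
(f ⊛ g) n k = sumTo n (λ i → sumTo k (λ j → f i j ℤ.* g (n ℕ.∸ i) (k ℕ.∸ j)))

Cser : PS
Cser n k = + (c n k)

Anum : PS
Anum = constPS (+ 1) ⊖ constPS (+ 2) ⊛ X ⊕ constPS (+ 2) ⊛ X ⊛ Y

Disc : PS
Disc = constPS (+ 1) ⊖ constPS (+ 4) ⊛ X ⊕ constPS (+ 4) ⊛ X ⊛ X ⊖ constPS (+ 4) ⊛ X ⊛ X ⊛ Y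

IsSqrtDisc : PS → Set
IsSqrtDisc S = (∀ n k → (S ⊛ S) n k ≡ Disc n k) × (S 0 0 ≡ + 1)

-- Every nonempty Catalan word is uniquely 0 ∷ (map suc w₁ ++ w₂) with w₁, w₂ Catalan words, w₂
-- empty or beginning at the second 0; its descents are those of w₁ and w₂ plus, when both are
-- nonempty, the step down into w₂.  For A = (C − 1)/x this gives A = 1 + 2xA + x²yA², and with
-- C = 1 + xA the polynomial identity
--   (1 − 2x + 2xy − 2xyC)² = 1 − 4x + 4x² − 4x²y + 4x²y (1 + 2xA + x²yA² − A)
-- shows that 1 − 2x + 2xy − 2xyC is a square root of the discriminant.

module Submission where

open import Defs
open import Algebra.Bundles using (CommutativeSemiring; CommutativeRing)
open import Data.Integer as ℤ using (ℤ; +_)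
import Data.Integer.Properties as ℤ
open import Data.Nat as ℕ using (ℕ; zero; suc; _≤_; _<_; _∸_; z≤n; s≤s)
import Data.Nat.Properties as ℕ
open import Data.Product using (∃-syntax; _×_; _,_)
open import Data.Sum using (inj₁; inj₂)
open import Function using (_∘_; id)
open import Relation.Binary.PropositionalEquality as ≡ using (_≡_; _≢_)
open import Relation.Nullary using (contradiction)

module FiniteSum {c ℓ} (R : CommutativeSemiring c ℓ) where

  open CommutativeSemiring R
  open import Relation.Binary.Reasoning.Setoid setoid
  open import Algebra.Properties.CommutativeSemigroup +-commutativeSemigroup using (interchange)

  ∑ : ℕ → (ℕ → Carrier) → Carrier
  ∑ zero    h = h 0
  ∑ (suc n) h = ∑ n h + h (suc n)

  ∑-cong≤ : ∀ n {g h} → (∀ i → i ≤ n → g i ≈ h i) → ∑ n g ≈ ∑ n h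
  ∑-cong≤ zero    g≈h = g≈h 0 z≤n
  ∑-cong≤ (suc n) g≈h = +-cong (∑-cong≤ n (λ i i≤n → g≈h i (ℕ.m≤n⇒m≤1+n i≤n))) (g≈h (suc n) ℕ.≤-refl)

  ∑-cong : ∀ n {g h} → (∀ i → g i ≈ h i) → ∑ n g ≈ ∑ n h
  ∑-cong n g≈h = ∑-cong≤ n (λ i _ → g≈h i)

  ∑-zero : ∀ n {h} → (∀ i → i ≤ n → h i ≈ 0#) → ∑ n h ≈ 0#
  ∑-zero zero    h≈0 = h≈0 0 z≤n
  ∑-zero (suc n) h≈0 =
    trans (+-cong (∑-zero n (λ i i≤n → h≈0 i (ℕ.m≤n⇒m≤1+n i≤n))) (h≈0 (suc n) ℕ.≤-refl)) (+-identityˡ 0#)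

  ∑-distrib-+ : ∀ n g h → ∑ n (λ i → g i + h i) ≈ ∑ n g + ∑ n h
  ∑-distrib-+ zero    g h = refl
  ∑-distrib-+ (suc n) g h = begin
    ∑ n (λ i → g i + h i) + (g (suc n) + h (suc n)) ≈⟨ +-congʳ (∑-distrib-+ n g h) ⟩
    (∑ n g + ∑ n h) + (g (suc n) + h (suc n))       ≈⟨ interchange _ _ _ _ ⟩
    (∑ n g + g (suc n)) + (∑ n h + h (suc n))       ∎

  *-distribˡ-∑ : ∀ n a h → a * ∑ n h ≈ ∑ n (λ i → a * h i)
  *-distribˡ-∑ zero    a h = refl
  *-distribˡ-∑ (suc n) a h = trans (distribˡ a (∑ n h) (h (suc n))) (+-congʳ (*-distribˡ-∑ n a h))

  *-distribʳ-∑ : ∀ n a h → ∑ n h * a ≈ ∑ n (λ i → h i * a)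
  *-distribʳ-∑ n a h = trans (*-comm (∑ n h) a) (trans (*-distribˡ-∑ n a h) (∑-cong n (λ i → *-comm a (h i))))

  ∑-head : ∀ n h → ∑ (suc n) h ≈ h 0 + ∑ n (h ∘ suc)
  ∑-head zero    h = refl
  ∑-head (suc n) h = trans (+-congʳ (∑-head n h)) (+-assoc (h 0) (∑ n (h ∘ suc)) (h (suc (suc n))))

  ∑-reverse : ∀ n h → ∑ n h ≈ ∑ n (λ i → h (n ∸ i))
  ∑-reverse zero    h = refl
  ∑-reverse (suc n) h = begin
    ∑ n h + h (suc n)                  ≈⟨ +-congʳ (∑-reverse n h) ⟩
    ∑ n (λ i → h (n ∸ i)) + h (suc n)  ≈⟨ +-comm _ _ ⟩
    h (suc n) + ∑ n (λ i → h (n ∸ i))  ≈⟨ ∑-head n (λ i → h (suc n ∸ i)) ⟨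
    ∑ (suc n) (λ i → h (suc n ∸ i))    ∎

  -- Both sides sum G j l over the triangle j + l ≤ n.
  ∑-triangle : ∀ n (G : ℕ → ℕ → Carrier) →
               ∑ n (λ i → ∑ i (λ j → G j (i ∸ j))) ≈ ∑ n (λ j → ∑ (n ∸ j) (G j))
  ∑-triangle zero    G = refl
  ∑-triangle (suc n) G = begin
    ∑ (suc n) (λ i → ∑ i (λ j → G j (i ∸ j)))
      ≈⟨ ∑-head n _ ⟩
    G 0 0 + ∑ n (λ i → ∑ (suc i) (λ j → G j (suc i ∸ j)))
      ≈⟨ +-congˡ (∑-cong n (λ i → ∑-head i (λ j → G j (suc i ∸ j)))) ⟩
    G 0 0 + ∑ n (λ i → G 0 (suc i) + ∑ i (λ j → G (suc j) (i ∸ j)))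
      ≈⟨ +-congˡ (∑-distrib-+ n _ _) ⟩
    G 0 0 + (∑ n (G 0 ∘ suc) + ∑ n (λ i → ∑ i (λ j → G (suc j) (i ∸ j))))
      ≈⟨ +-assoc _ _ _ ⟨
    (G 0 0 + ∑ n (G 0 ∘ suc)) + ∑ n (λ i → ∑ i (λ j → G (suc j) (i ∸ j)))
      ≈⟨ +-cong (∑-head n (G 0)) (sym (∑-triangle n (G ∘ suc))) ⟨
    ∑ (suc n) (G 0) + ∑ n (λ j → ∑ (n ∸ j) (G (suc j)))
      ≈⟨ ∑-head n (λ j → ∑ (suc n ∸ j) (G j)) ⟨
    ∑ (suc n) (λ j → ∑ (suc n ∸ j) (G j)) ∎

  ∑-comm : ∀ m n (G : ℕ → ℕ → Carrier) → ∑ m (λ i → ∑ n (G i)) ≈ ∑ n (λ j → ∑ m (λ i → G i j))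
  ∑-comm zero    n G = refl
  ∑-comm (suc m) n G = begin
    ∑ m (λ i → ∑ n (G i)) + ∑ n (G (suc m))                    ≈⟨ +-congʳ (∑-comm m n G) ⟩
    ∑ n (λ j → ∑ m (λ i → G i j)) + ∑ n (G (suc m))            ≈⟨ ∑-distrib-+ n _ _ ⟨
    ∑ n (λ j → ∑ m (λ i → G i j) + G (suc m) j)                ∎

  ∑-truncate : ∀ {m} n {h} → m ≤ n → (∀ i → m < i → h i ≈ 0#) → ∑ n h ≈ ∑ m h
  ∑-truncate zero    z≤n   h≈0 = refl
  ∑-truncate (suc n) m≤1+n h≈0 with ℕ.m≤n⇒m<n∨m≡n m≤1+n
  ... | inj₁ (s≤s m≤n) = trans (+-cong (∑-truncate n m≤n h≈0) (h≈0 (suc n) (s≤s m≤n))) (+-identityʳ _)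
  ... | inj₂ ≡.refl    = refl

  ∑-single : ∀ {p} n {h} → p ≤ n → (∀ i → i ≢ p → h i ≈ 0#) → ∑ n h ≈ h p
  ∑-single {zero}  n p≤n h≈0 = ∑-truncate n p≤n (λ i p<i → h≈0 i (ℕ.>⇒≢ p<i))
  ∑-single {suc p} n {h} p≤n h≈0 = begin
    ∑ n h                ≈⟨ ∑-truncate n p≤n (λ i p<i → h≈0 i (ℕ.>⇒≢ p<i)) ⟩
    ∑ p h + h (suc p)    ≈⟨ +-congʳ (∑-zero p (λ i i≤p → h≈0 i (ℕ.<⇒≢ (s≤s i≤p)))) ⟩
    0# + h (suc p)       ≈⟨ +-identityˡ (h (suc p)) ⟩
    h (suc p)            ∎

module PowerSeries {c ℓ} (R : CommutativeRing c ℓ) where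

  open CommutativeRing R hiding (isCommutativeRing)
  open FiniteSum commutativeSemiring public using (∑)
  open FiniteSum commutativeSemiring hiding (∑)
  open import Relation.Binary.Reasoning.Setoid setoid
  open import Algebra.Structures using (IsCommutativeRing)

  Series : Set c
  Series = ℕ → Carrier

  infix  4 _≋_
  infixl 6 _⊞_
  infixl 7 _⊠_

  _≋_ : Series → Series → Set ℓ
  f ≋ g = ∀ n → f n ≈ g n

  _⊞_ : Series → Series → Series
  (f ⊞ g) n = f n + g n

  ⊟_ : Series → Series
  (⊟ f) n = - f n

  𝟘 : Series
  𝟘 _ = 0#

  𝟙 : Series
  𝟙 zero    = 1#
  𝟙 (suc _) = 0#

  _⊠_ : Series → Series → Series
  (f ⊠ g) n = ∑ n (λ i → f i * g (n ∸ i))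

  ⊠-cong : ∀ {f f′ g g′} → f ≋ f′ → g ≋ g′ → f ⊠ g ≋ f′ ⊠ g′
  ⊠-cong f≋f′ g≋g′ n = ∑-cong n (λ i → *-cong (f≋f′ i) (g≋g′ (n ∸ i)))

  ⊠-comm : ∀ f g → f ⊠ g ≋ g ⊠ f
  ⊠-comm f g n = begin
    ∑ n (λ i → f i * g (n ∸ i))              ≈⟨ ∑-reverse n _ ⟩
    ∑ n (λ i → f (n ∸ i) * g (n ∸ (n ∸ i)))  ≈⟨ ∑-cong≤ n (λ i i≤n → trans (*-comm _ _)
                                                  (*-congʳ (reflexive (≡.cong g (ℕ.m∸[m∸n]≡n i≤n))))) ⟩
    ∑ n (λ i → g i * f (n ∸ i))              ∎

  ⊠-assoc : ∀ f g h → (f ⊠ g) ⊠ h ≋ f ⊠ (g ⊠ h)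
  ⊠-assoc f g h n = begin
    ∑ n (λ i → ∑ i (λ j → f j * g (i ∸ j)) * h (n ∸ i))
      ≈⟨ ∑-cong n (λ i → *-distribʳ-∑ i _ _) ⟩
    ∑ n (λ i → ∑ i (λ j → (f j * g (i ∸ j)) * h (n ∸ i)))
      ≈⟨ ∑-cong n (λ i → ∑-cong≤ i (λ j j≤i → trans (*-assoc _ _ _)
           (*-congˡ (*-congˡ (reflexive (≡.cong h (≡.sym (∸-∸ j≤i)))))))) ⟩
    ∑ n (λ i → ∑ i (λ j → f j * (g (i ∸ j) * h (n ∸ j ∸ (i ∸ j)))))
      ≈⟨ ∑-triangle n (λ j l → f j * (g l * h (n ∸ j ∸ l))) ⟩
    ∑ n (λ j → ∑ (n ∸ j) (λ l → f j * (g l * h (n ∸ j ∸ l))))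
      ≈⟨ ∑-cong n (λ j → *-distribˡ-∑ (n ∸ j) _ _) ⟨
    ∑ n (λ j → f j * ∑ (n ∸ j) (λ l → g l * h (n ∸ j ∸ l))) ∎
    where
    ∸-∸ : ∀ {i j} → j ≤ i → n ∸ j ∸ (i ∸ j) ≡ n ∸ i
    ∸-∸ {i} {j} j≤i = ≡.trans (ℕ.∸-+-assoc n j (i ∸ j)) (≡.cong (n ∸_) (ℕ.m+[n∸m]≡n j≤i))

  ⊠-identityˡ : ∀ f → 𝟙 ⊠ f ≋ f
  ⊠-identityˡ f n = trans (∑-single n z≤n 𝟙-off-zero) (*-identityˡ (f n))
    where
    𝟙-off-zero : ∀ i → i ≢ 0 → 𝟙 i * f (n ∸ i) ≈ 0#
    𝟙-off-zero zero    i≢0 = contradiction ≡.refl i≢0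
    𝟙-off-zero (suc i) _   = zeroˡ _

  ⊠-distribˡ : ∀ f g h → f ⊠ (g ⊞ h) ≋ f ⊠ g ⊞ f ⊠ h
  ⊠-distribˡ f g h n = trans (∑-cong n (λ i → distribˡ _ _ _)) (∑-distrib-+ n _ _)

  isCommutativeRing : IsCommutativeRing _≋_ _⊞_ _⊠_ ⊟_ 𝟘 𝟙
  isCommutativeRing = record
    { isRing = record
      { +-isAbelianGroup = record
        { isGroup = record
          { isMonoid = record
            { isSemigroup = record
              { isMagma = record
                { isEquivalence = record
                  { refl = λ n → refl ; sym = λ f≋g n → sym (f≋g n) ; trans = λ f≋g g≋h n → trans (f≋g n) (g≋h n) }
                ; ∙-cong = λ f≋f′ g≋g′ n → +-cong (f≋f′ n) (g≋g′ n) }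
              ; assoc = λ f g h n → +-assoc (f n) (g n) (h n) }
            ; identity = (λ f n → +-identityˡ (f n)) , (λ f n → +-identityʳ (f n)) }
          ; inverse = (λ f n → -‿inverseˡ (f n)) , (λ f n → -‿inverseʳ (f n))
          ; ⁻¹-cong = λ f≋g n → -‿cong (f≋g n) }
        ; comm = λ f g n → +-comm (f n) (g n) }
      ; *-cong = ⊠-cong
      ; *-assoc = ⊠-assoc
      ; *-identity = ⊠-identityˡ , (λ f n → trans (⊠-comm f 𝟙 n) (⊠-identityˡ f n))
      ; distrib = ⊠-distribˡ , (λ f g h n → trans (⊠-comm (g ⊞ h) f n)
                                   (trans (⊠-distribˡ f g h n) (+-cong (⊠-comm f g n) (⊠-comm f h n)))) }
    ; *-comm = ⊠-comm }

  commutativeRing : CommutativeRing c ℓ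
  commutativeRing = record { isCommutativeRing = isCommutativeRing }

module ReplaceMultiplication {c ℓ} (R : CommutativeRing c ℓ)
  (_∙_ : CommutativeRing.Carrier R → CommutativeRing.Carrier R → CommutativeRing.Carrier R)
  (ε : CommutativeRing.Carrier R)
  (∙≈* : ∀ x y → CommutativeRing._≈_ R (x ∙ y) (CommutativeRing._*_ R x y))
  (ε≈1# : CommutativeRing._≈_ R ε (CommutativeRing.1# R)) where

  open CommutativeRing R

  commutativeRing : CommutativeRing c ℓ
  commutativeRing = record
    { _*_ = _∙_
    ; 1#  = ε
    ; isCommutativeRing = record
      { isRing = record
        { +-isAbelianGroup = +-isAbelianGroup
        ; *-cong = λ x≈x′ y≈y′ → trans (∙≈* _ _) (trans (*-cong x≈x′ y≈y′) (sym (∙≈* _ _)))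
        ; *-assoc = λ x y z → trans (∙≈* _ z) (trans (*-congʳ (∙≈* x y)) (trans (*-assoc x y z)
                                (sym (trans (∙≈* x _) (*-congˡ (∙≈* y z))))))
        ; *-identity = (λ x → trans (∙≈* ε x) (trans (*-congʳ ε≈1#) (*-identityˡ x)))
                     , (λ x → trans (∙≈* x ε) (trans (*-congˡ ε≈1#) (*-identityʳ x)))
        ; distrib = (λ x y z → trans (∙≈* x _) (trans (distribˡ x y z) (sym (+-cong (∙≈* x y) (∙≈* x z)))))
                  , (λ x y z → trans (∙≈* _ x) (trans (distribʳ x y z) (sym (+-cong (∙≈* y x) (∙≈* z x)))))
        }
      ; *-comm = λ x y → trans (∙≈* x y) (trans (*-comm x y) (sym (∙≈* y x)))
      }
    }

open import Algebra.Solver.Ring.AlmostCommutativeRing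
  using (fromCommutativeRing; _-Raw-AlmostCommutative⟶_; Induced-equivalence)
open import Data.Maybe using (just; nothing)
open import Relation.Binary.Definitions using (WeaklyDecidable)
open import Relation.Binary.PropositionalEquality using (refl; cong; cong₂; module ≡-Reasoning)
open import Relation.Nullary using (yes; no)

module ℤ-Sum = FiniteSum (CommutativeRing.commutativeSemiring ℤ.+-*-commutativeRing)

sumTo≡∑ : ∀ n h → sumTo n h ≡ ℤ-Sum.∑ n h
sumTo≡∑ zero    h = refl
sumTo≡∑ (suc n) h = cong (ℤ._+ h (suc n)) (sumTo≡∑ n h)

sumTo-cong : ∀ n {g h} → (∀ i → g i ≡ h i) → sumTo n g ≡ sumTo n h
sumTo-cong n {g} {h} g≗h = ≡.trans (sumTo≡∑ n g) (≡.trans (ℤ-Sum.∑-cong n g≗h) (≡.sym (sumTo≡∑ n h)))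

sumTo-single : ∀ {p} n {h} → p ≤ n → (∀ i → i ≢ p → h i ≡ + 0) → sumTo n h ≡ h p
sumTo-single n {h} p≤n h≡0 = ≡.trans (sumTo≡∑ n h) (ℤ-Sum.∑-single n p≤n h≡0)

constPS-⊛ : ∀ a f n k → (constPS a ⊛ f) n k ≡ a ℤ.* f n k
constPS-⊛ a f n k = ≡.trans (sumTo-single n z≤n (λ i i≢0 → ≡.trans (sumTo-single k z≤n (λ j _ → off-row i i≢0 j))
                                                                  (off-row i i≢0 0)))
                            (sumTo-single k z≤n off-col)
  where
  off-row : ∀ i → i ≢ 0 → ∀ j → constPS a i j ℤ.* f (n ∸ i) (k ∸ j) ≡ + 0
  off-row zero    i≢0 j = contradiction refl i≢0
  off-row (suc i) _   j = refl
  off-col : ∀ j → j ≢ 0 → constPS a 0 j ℤ.* f n (k ∸ j) ≡ + 0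
  off-col zero    j≢0 = contradiction refl j≢0
  off-col (suc j) _   = refl

module ℤ⟦y⟧    = PowerSeries ℤ.+-*-commutativeRing
module ℤ⟦y⟧⟦x⟧ = PowerSeries ℤ⟦y⟧.commutativeRing

⊛≋⊠ : ∀ f g → (f ⊛ g) ℤ⟦y⟧⟦x⟧.≋ (f ℤ⟦y⟧⟦x⟧.⊠ g)
⊛≋⊠ f g n k = ≡.sym (≡.trans (apply n _) (sumTo-cong n (λ i → ≡.sym (sumTo≡∑ k _))))
  where
  apply : ∀ n H → ℤ⟦y⟧⟦x⟧.∑ n H k ≡ sumTo n (λ i → H i k)
  apply zero    H = refl
  apply (suc n) H = cong (ℤ._+ H (suc n) k) (apply n H)

constPS-1≋𝟙 : constPS (+ 1) ℤ⟦y⟧⟦x⟧.≋ ℤ⟦y⟧⟦x⟧.𝟙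
constPS-1≋𝟙 zero    zero    = refl
constPS-1≋𝟙 zero    (suc k) = refl
constPS-1≋𝟙 (suc n) k       = refl

-- ℤ⟦y⟧⟦x⟧ is the ring of PS, but its product and unit agree with _⊛_ and constPS (+ 1) only
-- pointwise; substituting them lets ring-level statements mention the operations of Defs verbatim.
ℤ⟦x,y⟧ : CommutativeRing _ _
ℤ⟦x,y⟧ = ReplaceMultiplication.commutativeRing ℤ⟦y⟧⟦x⟧.commutativeRing _⊛_ (constPS (+ 1)) ⊛≋⊠ constPS-1≋𝟙

-- Through this embedding the ring solver reads constPS (+ 2) and constPS (+ 4) as integer coefficients.
constPS-homomorphism : CommutativeRing.rawRing ℤ.+-*-commutativeRing -Raw-AlmostCommutative⟶ fromCommutativeRing ℤ⟦x,y⟧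
constPS-homomorphism = record
  { ⟦_⟧    = constPS
  ; +-homo = +-homo
  ; *-homo = λ a b n k → ≡.sym (≡.trans (constPS-⊛ a (constPS b) n k) (*-homo a b n k))
  ; -‿homo = -‿homo
  ; 0-homo = 0-homo
  ; 1-homo = λ _ _ → refl
  }
  where
  +-homo : ∀ a b n k → constPS (a ℤ.+ b) n k ≡ constPS a n k ℤ.+ constPS b n k
  +-homo a b zero    zero    = refl
  +-homo a b zero    (suc k) = refl
  +-homo a b (suc n) k       = refl
  *-homo : ∀ a b n k → a ℤ.* constPS b n k ≡ constPS (a ℤ.* b) n k
  *-homo a b zero    zero    = refl
  *-homo a b zero    (suc k) = ℤ.*-zeroʳ a
  *-homo a b (suc n) k       = ℤ.*-zeroʳ a
  -‿homo : ∀ a n k → constPS (ℤ.- a) n k ≡ ℤ.- constPS a n k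
  -‿homo a zero    zero    = refl
  -‿homo a zero    (suc k) = refl
  -‿homo a (suc n) k       = refl
  0-homo : ∀ n k → constPS (+ 0) n k ≡ + 0
  0-homo zero    zero    = refl
  0-homo zero    (suc k) = refl
  0-homo (suc n) k       = refl

constPS-≟ : WeaklyDecidable (Induced-equivalence constPS-homomorphism)
constPS-≟ a b with a ℤ.≟ b
... | yes refl = just (λ _ _ → refl)
... | no _     = nothing

module Discriminant where

  open CommutativeRing ℤ⟦x,y⟧
    using (_≈_; setoid; 0#; -_; trans; sym; *-cong; *-congˡ; +-congˡ; +-congʳ; -‿cong; -‿inverseʳ; zeroʳ; +-identityʳ)
  open import Relation.Binary.Reasoning.Setoid setoid
  open import Algebra.Solver.Ring (CommutativeRing.rawRing ℤ.+-*-commutativeRing) (fromCommutativeRing ℤ⟦x,y⟧)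
    constPS-homomorphism constPS-≟
    using (solve; _:=_; con; _:+_; _:*_; _:-_)

  rootΔ : PS → PS → PS → PS
  rootΔ x y c = constPS (+ 1) ⊖ constPS (+ 2) ⊛ x ⊕ constPS (+ 2) ⊛ x ⊛ y ⊖ constPS (+ 2) ⊛ x ⊛ y ⊛ c

  Δ : PS → PS → PS
  Δ x y = constPS (+ 1) ⊖ constPS (+ 4) ⊛ x ⊕ constPS (+ 4) ⊛ x ⊛ x ⊖ constPS (+ 4) ⊛ x ⊛ x ⊛ y

  Φ : PS → PS → PS → PS
  Φ x y a = constPS (+ 1) ⊕ x ⊛ a ⊕ x ⊛ a ⊕ x ⊛ (y ⊛ (x ⊛ (a ⊛ a)))

  square-rootΔ : ∀ x y a → rootΔ x y (constPS (+ 1) ⊕ x ⊛ a) ⊛ rootΔ x y (constPS (+ 1) ⊕ x ⊛ a)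
                         ≈ Δ x y ⊕ constPS (+ 4) ⊛ x ⊛ y ⊛ x ⊛ (Φ x y a ⊖ a)
  square-rootΔ = solve 3 (λ x y a →
    let r = con (+ 1) :- con (+ 2) :* x :+ con (+ 2) :* x :* y :- con (+ 2) :* x :* y :* (con (+ 1) :+ x :* a)
    in r :* r
       := con (+ 1) :- con (+ 4) :* x :+ con (+ 4) :* x :* x :- con (+ 4) :* x :* x :* y
          :+ con (+ 4) :* x :* y :* x :* (con (+ 1) :+ x :* a :+ x :* a :+ x :* (y :* (x :* (a :* a))) :- a)) (λ _ _ → refl)

  t≈u⊖[u⊖t] : ∀ u t → t ≈ u ⊖ (u ⊖ t)
  t≈u⊖[u⊖t] = solve 2 (λ u t → t := u :- (u :- t)) (λ _ _ → refl)

  rootΔ-squared : ∀ x y a c → c ≈ constPS (+ 1) ⊕ x ⊛ a → a ≈ Φ x y a → rootΔ x y c ⊛ rootΔ x y c ≈ Δ x y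
  rootΔ-squared x y a c c≈1+xa a≈Φa = begin
    rootΔ x y c ⊛ rootΔ x y c    ≈⟨ *-cong root≈ root≈ ⟩
    rootΔ x y c₀ ⊛ rootΔ x y c₀  ≈⟨ square-rootΔ x y a ⟩
    Δ x y ⊕ K ⊛ (Φ x y a ⊖ a)    ≈⟨ +-congˡ {Δ x y} (trans (*-congˡ {K} Φa-a≈0) (zeroʳ K)) ⟩
    Δ x y ⊕ 0#                   ≈⟨ +-identityʳ (Δ x y) ⟩
    Δ x y                        ∎
    where
    c₀ K : PS
    c₀ = constPS (+ 1) ⊕ x ⊛ a
    K  = constPS (+ 4) ⊛ x ⊛ y ⊛ x
    root≈ : rootΔ x y c ≈ rootΔ x y c₀
    root≈ = +-congˡ {constPS (+ 1) ⊖ constPS (+ 2) ⊛ x ⊕ constPS (+ 2) ⊛ x ⊛ y}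
              (-‿cong (*-congˡ {constPS (+ 2) ⊛ x ⊛ y} c≈1+xa))
    Φa-a≈0 : Φ x y a ⊖ a ≈ 0#
    Φa-a≈0 = trans (+-congʳ { - a } (sym a≈Φa)) (-‿inverseʳ a)

open Discriminant

X-⊛-zero : ∀ f k → (X ⊛ f) 0 k ≡ + 0
X-⊛-zero f k = sumTo-single k z≤n (λ _ _ → refl)

X-⊛-suc : ∀ f n k → (X ⊛ f) (suc n) k ≡ f n k
X-⊛-suc f n k = ≡.trans (sumTo-single (suc n) (s≤s z≤n) off-row)
                        (≡.trans (sumTo-single k z≤n off-col) (ℤ.*-identityˡ (f n k)))
  where
  off-row : ∀ i → i ≢ 1 → sumTo k (λ j → X i j ℤ.* f (suc n ∸ i) (k ∸ j)) ≡ + 0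
  off-row zero          _   = sumTo-single k z≤n (λ _ _ → refl)
  off-row (suc zero)    i≢1 = contradiction refl i≢1
  off-row (suc (suc i)) _   = sumTo-single k z≤n (λ _ _ → refl)
  off-col : ∀ j → j ≢ 0 → X 1 j ℤ.* f n (k ∸ j) ≡ + 0
  off-col zero    j≢0 = contradiction refl j≢0
  off-col (suc j) _   = refl

Y-⊛-zero : ∀ f n → (Y ⊛ f) n 0 ≡ + 0
Y-⊛-zero f n = sumTo-single n z≤n off-row
  where
  off-row : ∀ i → i ≢ 0 → Y i 0 ℤ.* f (n ∸ i) 0 ≡ + 0
  off-row zero    i≢0 = contradiction refl i≢0
  off-row (suc i) _   = refl

Y-⊛-suc : ∀ f n k → (Y ⊛ f) n (suc k) ≡ f n k
Y-⊛-suc f n k = ≡.trans (sumTo-single n z≤n off-row)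
                        (≡.trans (sumTo-single (suc k) (s≤s z≤n) off-col) (ℤ.*-identityˡ (f n k)))
  where
  off-row : ∀ i → i ≢ 0 → sumTo (suc k) (λ j → Y i j ℤ.* f (n ∸ i) (suc k ∸ j)) ≡ + 0
  off-row zero    i≢0 = contradiction refl i≢0
  off-row (suc i) _   = sumTo-single (suc k) z≤n (λ _ _ → refl)
  off-col : ∀ j → j ≢ 1 → Y 0 j ℤ.* f n (suc k ∸ j) ≡ + 0
  off-col zero          _   = refl
  off-col (suc zero)    j≢1 = contradiction refl j≢1
  off-col (suc (suc j)) _   = refl

open import Algebra.Properties.CommutativeSemigroup ℕ.+-commutativeSemigroup using (x∙yz≈y∙xz)
open import Data.Bool using (if_then_else_; true; false)
open import Data.List using (List; []; _∷_; _++_; length; filter; map; concatMap; applyUpTo)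
import Data.List.Properties as List
open import Data.List.Relation.Unary.Linked using (linked?)
open import Data.Nat using (_+_; _*_; _≟_; _≤?_)
open import Data.Nat.ListAction using (sum)
open import Data.Nat.ListAction.Properties using (sum-++)
open import Relation.Nullary using (Dec; does; ¬_; _×-dec_)
open import Relation.Nullary.Decidable using (dec-true; dec-false)
open import Relation.Unary using (Decidable)

open FiniteSum ℕ.+-*-commutativeSemiring

𝟙[_] : ∀ {p} {P : Set p} → Dec P → ℕ
𝟙[ P? ] = if does P? then 1 else 0

𝟙[yes] : ∀ {p} {P : Set p} (P? : Dec P) → P → 𝟙[ P? ] ≡ 1
𝟙[yes] P? p = cong (if_then 1 else 0) (dec-true P? p)

𝟙[no] : ∀ {p} {P : Set p} (P? : Dec P) → ¬ P → 𝟙[ P? ] ≡ 0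
𝟙[no] P? ¬p = cong (if_then 1 else 0) (dec-false P? ¬p)

𝟙[×] : ∀ {p q} {P : Set p} {Q : Set q} (P? : Dec P) (Q? : Dec Q) → 𝟙[ P? ×-dec Q? ] ≡ 𝟙[ P? ] * 𝟙[ Q? ]
𝟙[×] (yes _) (yes _) = refl
𝟙[×] (yes _) (no _)  = refl
𝟙[×] (no _)  _       = refl

length-filter : ∀ {a p} {A : Set a} {P : A → Set p} (P? : Decidable P) xs →
                length (filter P? xs) ≡ sum (map (λ x → 𝟙[ P? x ]) xs)
length-filter P? []       = refl
length-filter P? (x ∷ xs) with does (P? x)
... | true  = cong suc (length-filter P? xs)
... | false = length-filter P? xs

sum-map-concatMap : ∀ {a b} {A : Set a} {B : Set b} (f : B → ℕ) (h : A → List B) xs →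
                    sum (map f (concatMap h xs)) ≡ sum (map (λ x → sum (map f (h x))) xs)
sum-map-concatMap f h []       = refl
sum-map-concatMap f h (x ∷ xs) = begin
  sum (map f (h x ++ concatMap h xs))                 ≡⟨ cong sum (List.map-++ f (h x) (concatMap h xs)) ⟩
  sum (map f (h x) ++ map f (concatMap h xs))         ≡⟨ sum-++ (map f (h x)) _ ⟩
  sum (map f (h x)) + sum (map f (concatMap h xs))    ≡⟨ cong (_+_ (sum (map f (h x)))) (sum-map-concatMap f h xs) ⟩
  sum (map f (h x)) + sum (map (λ x → sum (map f (h x))) xs) ∎
  where open ≡-Reasoning

sum-map-applyUpTo : ∀ (g h : ℕ → ℕ) b → sum (map g (applyUpTo h (suc b))) ≡ ∑ b (g ∘ h)
sum-map-applyUpTo g h zero    = ℕ.+-identityʳ (g (h 0))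
sum-map-applyUpTo g h (suc b) = ≡.trans (cong (_+_ (g (h 0))) (sum-map-applyUpTo g (h ∘ suc) b)) (≡.sym (∑-head b (g ∘ h)))

∑words : ℕ → ℕ → (List ℕ → ℕ) → ℕ
∑words zero    b f = f []
∑words (suc n) b f = ∑ b (λ x → ∑words n b (λ t → f (x ∷ t)))

sum-map-words : ∀ n b f → sum (map f (words n (suc b))) ≡ ∑words n b f
sum-map-words zero    b f = ℕ.+-identityʳ (f [])
sum-map-words (suc n) b f = begin
  sum (map f (concatMap (λ x → map (x ∷_) (words n (suc b))) (applyUpTo id (suc b))))
    ≡⟨ sum-map-concatMap f (λ x → map (x ∷_) (words n (suc b))) (applyUpTo id (suc b)) ⟩
  sum (map (λ x → sum (map f (map (x ∷_) (words n (suc b))))) (applyUpTo id (suc b)))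
    ≡⟨ sum-map-applyUpTo _ id b ⟩
  ∑ b (λ x → sum (map f (map (x ∷_) (words n (suc b)))))
    ≡⟨ ∑-cong b (λ x → ≡.trans (cong sum (≡.sym (List.map-∘ (words n (suc b)))))
                               (sum-map-words n b (λ t → f (x ∷ t)))) ⟩
  ∑words (suc n) b f ∎
  where open ≡-Reasoning

∑words-cong : ∀ n b {f g} → (∀ t → f t ≡ g t) → ∑words n b f ≡ ∑words n b g
∑words-cong zero    b f≗g = f≗g []
∑words-cong (suc n) b f≗g = ∑-cong b (λ x → ∑words-cong n b (λ t → f≗g (x ∷ t)))

*-distribˡ-∑words : ∀ n b a f → a * ∑words n b f ≡ ∑words n b (λ t → a * f t)
*-distribˡ-∑words zero    b a f = refl
*-distribˡ-∑words (suc n) b a f = ≡.trans (*-distribˡ-∑ b a _) (∑-cong b (λ x → *-distribˡ-∑words n b a _))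

-- ∑tails a n g sums g over the words t of length n such that a ∷ t satisfies the Catalan step condition.
∑tails : ℕ → ℕ → (List ℕ → ℕ) → ℕ
∑tails a zero    g = g []
∑tails a (suc n) g = ∑ (suc a) (λ x → ∑tails x n (λ t → g (x ∷ t)))

∑words-linked : ∀ a n b g → a + n ≤ b →
                ∑words n b (λ t → 𝟙[ linked? step? (a ∷ t) ] * g t) ≡ ∑tails a n g
∑words-linked a zero    b g _     = ℕ.*-identityˡ (g [])
∑words-linked a (suc n) b g a+n≤b = begin
  ∑ b (λ x → ∑words n b (λ t → 𝟙[ linked? step? (a ∷ x ∷ t) ] * g (x ∷ t)))
    ≡⟨ ∑-cong b (λ x → ∑words-cong n b (λ t → ≡.trans
         (cong (_* g (x ∷ t)) (𝟙[×] (x ≤? suc a) (linked? step? (x ∷ t)))) (ℕ.*-assoc 𝟙[ x ≤? suc a ] _ _))) ⟩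
  ∑ b (λ x → ∑words n b (λ t → 𝟙[ x ≤? suc a ] * (𝟙[ linked? step? (x ∷ t) ] * g (x ∷ t))))
    ≡⟨ ∑-cong b (λ x → *-distribˡ-∑words n b 𝟙[ x ≤? suc a ] _) ⟨
  ∑ b (λ x → 𝟙[ x ≤? suc a ] * ∑words n b (λ t → 𝟙[ linked? step? (x ∷ t) ] * g (x ∷ t)))
    ≡⟨ ∑-truncate b 1+a≤b (λ x 1+a<x → cong (_* _) (𝟙[no] (x ≤? suc a) (ℕ.<⇒≱ 1+a<x))) ⟩
  ∑ (suc a) (λ x → 𝟙[ x ≤? suc a ] * ∑words n b (λ t → 𝟙[ linked? step? (x ∷ t) ] * g (x ∷ t)))
    ≡⟨ ∑-cong≤ (suc a) (λ x x≤1+a → ≡.trans (cong (_* _) (𝟙[yes] (x ≤? suc a) x≤1+a))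
         (≡.trans (ℕ.*-identityˡ _) (∑words-linked x n b _ (ℕ.≤-trans (ℕ.+-monoˡ-≤ n x≤1+a) 1+a+n≤b)))) ⟩
  ∑ (suc a) (λ x → ∑tails x n (λ t → g (x ∷ t))) ∎
  where
  open ≡-Reasoning
  1+a+n≤b : suc a + n ≤ b
  1+a+n≤b = ℕ.≤-trans (ℕ.≤-reflexive (≡.sym (ℕ.+-suc a n))) a+n≤b
  1+a≤b : suc a ≤ b
  1+a≤b = ℕ.≤-trans (ℕ.m≤m+n (suc a) n) 1+a+n≤b

∑words-zero : ∀ n b → ∑words n b (λ _ → 0) ≡ 0
∑words-zero n b = ≡.sym (*-distribˡ-∑words n b 0 (λ _ → 0))

c′ : ℕ → ℕ → ℕ
c′ n k = ∑tails 0 n (λ t → 𝟙[ des (0 ∷ t) ≟ k ])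

c-suc : ∀ n k → c (suc n) k ≡ c′ n k
c-suc n k = begin
  length (filter P? (words (suc n) (suc n)))                      ≡⟨ length-filter P? (words (suc n) (suc n)) ⟩
  sum (map (λ w → 𝟙[ P? w ]) (words (suc n) (suc n)))             ≡⟨ sum-map-words (suc n) n _ ⟩
  ∑ n (λ x → ∑words n n (λ t → 𝟙[ P? (x ∷ t) ]))                  ≡⟨ ∑-single n z≤n first-letter-0 ⟩
  ∑words n n (λ t → 𝟙[ P? (0 ∷ t) ])
    ≡⟨ ∑words-cong n n (λ t → 𝟙[×] (linked? step? (0 ∷ t)) (des (0 ∷ t) ≟ k)) ⟩
  ∑words n n (λ t → 𝟙[ linked? step? (0 ∷ t) ] * 𝟙[ des (0 ∷ t) ≟ k ]) ≡⟨ ∑words-linked 0 n n _ ℕ.≤-refl ⟩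
  c′ n k ∎
  where
  open ≡-Reasoning
  P? : Decidable (λ w → IsCatalan w × des w ≡ k)
  P? w = isCatalan? w ×-dec (des w ≟ k)
  first-letter-0 : ∀ x → x ≢ 0 → ∑words n n (λ t → 𝟙[ P? (x ∷ t) ]) ≡ 0
  first-letter-0 zero    x≢0 = contradiction refl x≢0
  first-letter-0 (suc x) _   = ∑words-zero n n

∑tails-cong : ∀ a n {f g} → (∀ t → f t ≡ g t) → ∑tails a n f ≡ ∑tails a n g
∑tails-cong a zero    f≗g = f≗g []
∑tails-cong a (suc n) f≗g = ∑-cong (suc a) (λ x → ∑tails-cong x n (λ t → f≗g (x ∷ t)))

∑tails-distrib-+ : ∀ a n f g → ∑tails a n (λ t → f t + g t) ≡ ∑tails a n f + ∑tails a n g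
∑tails-distrib-+ a zero    f g = refl
∑tails-distrib-+ a (suc n) f g =
  ≡.trans (∑-cong (suc a) (λ x → ∑tails-distrib-+ x n _ _)) (∑-distrib-+ (suc a) _ _)

*-distribˡ-∑tails : ∀ a n c f → c * ∑tails a n f ≡ ∑tails a n (λ t → c * f t)
*-distribˡ-∑tails a zero    c f = refl
*-distribˡ-∑tails a (suc n) c f =
  ≡.trans (*-distribˡ-∑ (suc a) c _) (∑-cong (suc a) (λ x → *-distribˡ-∑tails x n c _))

∑tails-zero : ∀ a n → ∑tails a n (λ _ → 0) ≡ 0
∑tails-zero a n = ≡.sym (*-distribˡ-∑tails a n 0 (λ _ → 0))

∑tails-∑ : ∀ a n m (G : ℕ → List ℕ → ℕ) →
           ∑tails a n (λ t → ∑ m (λ j → G j t)) ≡ ∑ m (λ j → ∑tails a n (G j))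
∑tails-∑ a n zero    G = refl
∑tails-∑ a n (suc m) G = ≡.trans (∑tails-distrib-+ a n _ _) (cong (_+ ∑tails a n (G (suc m))) (∑tails-∑ a n m G))

∑tails-product : ∀ a m b n f g → ∑tails a m (λ u → ∑tails b n (λ v → f u * g v)) ≡ ∑tails a m f * ∑tails b n g
∑tails-product a m b n f g = begin
  ∑tails a m (λ u → ∑tails b n (λ v → f u * g v))  ≡⟨ ∑tails-cong a m (λ u → *-distribˡ-∑tails b n (f u) g) ⟨
  ∑tails a m (λ u → f u * ∑tails b n g)            ≡⟨ ∑tails-cong a m (λ u → ℕ.*-comm (f u) (∑tails b n g)) ⟩
  ∑tails a m (λ u → ∑tails b n g * f u)            ≡⟨ *-distribˡ-∑tails a m (∑tails b n g) f ⟨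
  ∑tails b n g * ∑tails a m f                      ≡⟨ ℕ.*-comm (∑tails b n g) (∑tails a m f) ⟩
  ∑tails a m f * ∑tails b n g                      ∎
  where open ≡-Reasoning

-- The part of ∑tails (suc a) n g coming from tails that contain a 0, cut as map suc u ++ 0 ∷ v at the first 0.
firstZero : ℕ → ℕ → (List ℕ → ℕ) → ℕ
firstZero a zero    g = 0
firstZero a (suc m) g = ∑ m (λ i → ∑tails a i (λ u → ∑tails 0 (m ∸ i) (λ v → g (map suc u ++ 0 ∷ v))))

firstZero-suc : ∀ a m g →
  ∑tails 0 m (λ v → g (0 ∷ v)) + ∑ (suc a) (λ x → firstZero x m (λ t → g (suc x ∷ t))) ≡ firstZero a (suc m) g
firstZero-suc a zero    g = ≡.trans (cong (_+_ (g (0 ∷ []))) (∑-zero (suc a) (λ _ _ → refl))) (ℕ.+-identityʳ _)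
firstZero-suc a (suc m) g = ≡.trans (cong (_+_ (∑tails 0 (suc m) (λ v → g (0 ∷ v)))) (∑-comm (suc a) m _))
                                     (≡.sym (∑-head m _))

∑tails-split : ∀ a n g → ∑tails (suc a) n g ≡ ∑tails a n (λ u → g (map suc u)) + firstZero a n g
∑tails-split a zero    g = ≡.sym (ℕ.+-identityʳ (g []))
∑tails-split a (suc m) g = begin
  ∑ (suc (suc a)) (λ x → ∑tails x m (λ t → g (x ∷ t)))
    ≡⟨ ∑-head (suc a) _ ⟩
  Z + ∑ (suc a) (λ x → ∑tails (suc x) m (λ t → g (suc x ∷ t)))
    ≡⟨ cong (_+_ Z) (∑-cong (suc a) (λ x → ∑tails-split x m (λ t → g (suc x ∷ t)))) ⟩
  Z + ∑ (suc a) (λ x → ∑tails x m (λ u → g (suc x ∷ map suc u)) + firstZero x m (λ t → g (suc x ∷ t)))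
    ≡⟨ cong (_+_ Z) (∑-distrib-+ (suc a) _ _) ⟩
  Z + (∑tails a (suc m) (λ u → g (map suc u)) + F)
    ≡⟨ x∙yz≈y∙xz Z (∑tails a (suc m) (λ u → g (map suc u))) F ⟩
  ∑tails a (suc m) (λ u → g (map suc u)) + (Z + F)
    ≡⟨ cong (_+_ (∑tails a (suc m) (λ u → g (map suc u)))) (firstZero-suc a m g) ⟩
  ∑tails a (suc m) (λ u → g (map suc u)) + firstZero a (suc m) g ∎
  where
  open ≡-Reasoning
  Z F : ℕ
  Z = ∑tails 0 m (λ v → g (0 ∷ v))
  F = ∑ (suc a) (λ x → firstZero x m (λ t → g (suc x ∷ t)))

des-map-suc : ∀ w → des (map suc w) ≡ des w
des-map-suc []          = refl
des-map-suc (a ∷ [])    = refl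
des-map-suc (a ∷ b ∷ t) = cong (_+_ (if b ℕ.<ᵇ a then 1 else 0)) (des-map-suc (b ∷ t))

des-split : ∀ a u v → des (suc a ∷ map suc u ++ 0 ∷ v) ≡ suc (des (a ∷ u) + des (0 ∷ v))
des-split a []      v = refl
des-split a (x ∷ u) v = ≡.trans (cong (_+_ d) (des-split x u v))
                                (≡.trans (ℕ.+-suc d _) (cong suc (≡.sym (ℕ.+-assoc d (des (x ∷ u)) (des (0 ∷ v))))))
  where
  d : ℕ
  d = if x ℕ.<ᵇ a then 1 else 0

𝟙[+≟] : ∀ p q k → 𝟙[ p + q ≟ k ] ≡ ∑ k (λ j → 𝟙[ p ≟ j ] * 𝟙[ q ≟ k ∸ j ])
𝟙[+≟] zero    q k       = ≡.sym (≡.trans (∑-single k z≤n off) (ℕ.*-identityˡ 𝟙[ q ≟ k ]))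
  where
  off : ∀ j → j ≢ 0 → 𝟙[ 0 ≟ j ] * 𝟙[ q ≟ k ∸ j ] ≡ 0
  off zero    j≢0 = contradiction refl j≢0
  off (suc j) _   = refl
𝟙[+≟] (suc p) q zero    = refl
𝟙[+≟] (suc p) q (suc k) = ≡.trans (𝟙[+≟] p q k) (≡.sym (∑-head k _))

-- Counts the words 0 ∷ (map suc w₁ ++ w₂) of length m + 2 with k descents and w₁, w₂ nonempty.
cross : ℕ → ℕ → ℕ
cross (suc m) (suc k) = ∑ m (λ i → ∑ k (λ j → c′ i j * c′ (m ∸ i) (k ∸ j)))
cross _       _       = 0

firstZero-des : ∀ m k → firstZero 0 m (λ t → 𝟙[ des (1 ∷ t) ≟ k ]) ≡ cross m k
firstZero-des zero    k       = refl
firstZero-des (suc m) zero    = ∑-zero m (λ i _ → ≡.trans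
  (∑tails-cong 0 i (λ u → ≡.trans (∑tails-cong 0 (m ∸ i) (λ v → cong (λ d → 𝟙[ d ≟ 0 ]) (des-split 0 u v)))
                                  (∑tails-zero 0 (m ∸ i))))
  (∑tails-zero 0 i))
firstZero-des (suc m) (suc k) = ∑-cong m (λ i → begin
  ∑tails 0 i (λ u → ∑tails 0 (m ∸ i) (λ v → 𝟙[ des (1 ∷ map suc u ++ 0 ∷ v) ≟ suc k ]))
    ≡⟨ ∑tails-cong 0 i (λ u → ∑tails-cong 0 (m ∸ i) (λ v →
         ≡.trans (cong (λ d → 𝟙[ d ≟ suc k ]) (des-split 0 u v)) (𝟙[+≟] (des (0 ∷ u)) (des (0 ∷ v)) k))) ⟩
  ∑tails 0 i (λ u → ∑tails 0 (m ∸ i) (λ v → ∑ k (λ j → δ u j * δ v (k ∸ j))))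
    ≡⟨ ∑tails-cong 0 i (λ u → ∑tails-∑ 0 (m ∸ i) k (λ j v → δ u j * δ v (k ∸ j))) ⟩
  ∑tails 0 i (λ u → ∑ k (λ j → ∑tails 0 (m ∸ i) (λ v → δ u j * δ v (k ∸ j))))
    ≡⟨ ∑tails-∑ 0 i k (λ j u → ∑tails 0 (m ∸ i) (λ v → δ u j * δ v (k ∸ j))) ⟩
  ∑ k (λ j → ∑tails 0 i (λ u → ∑tails 0 (m ∸ i) (λ v → δ u j * δ v (k ∸ j))))
    ≡⟨ ∑-cong k (λ j → ∑tails-product 0 i 0 (m ∸ i) (λ u → δ u j) (λ v → δ v (k ∸ j))) ⟩
  ∑ k (λ j → c′ i j * c′ (m ∸ i) (k ∸ j)) ∎)
  where
  open ≡-Reasoning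
  δ : List ℕ → ℕ → ℕ
  δ t j = 𝟙[ des (0 ∷ t) ≟ j ]

-- The second letter of 0 ∷ t is 0 or 1; in the latter case ∑tails-split cuts the rest at its first 0.
c′-suc : ∀ m k → c′ (suc m) k ≡ c′ m k + c′ m k + cross m k
c′-suc m k = begin
  c′ m k + ∑tails 1 m (λ t → 𝟙[ des (1 ∷ t) ≟ k ])
    ≡⟨ cong (_+_ (c′ m k)) (∑tails-split 0 m _) ⟩
  c′ m k + (∑tails 0 m (λ u → 𝟙[ des (map suc (0 ∷ u)) ≟ k ]) + firstZero 0 m (λ t → 𝟙[ des (1 ∷ t) ≟ k ]))
    ≡⟨ cong (_+_ (c′ m k)) (cong₂ _+_ (∑tails-cong 0 m (λ u → cong (λ d → 𝟙[ d ≟ k ]) (des-map-suc (0 ∷ u))))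
                                     (firstZero-des m k)) ⟩
  c′ m k + (c′ m k + cross m k)
    ≡⟨ ℕ.+-assoc (c′ m k) (c′ m k) (cross m k) ⟨
  c′ m k + c′ m k + cross m k ∎
  where open ≡-Reasoning

pos-sumTo : ∀ n h → sumTo n (λ i → + h i) ≡ + ∑ n h
pos-sumTo zero    h = refl
pos-sumTo (suc n) h = ≡.trans (cong (ℤ._+ + h (suc n)) (pos-sumTo n h)) (≡.sym (ℤ.pos-+ (∑ n h) (h (suc n))))

pos-⊛ : ∀ (f g : ℕ → ℕ → ℕ) n k → ((λ n k → + f n k) ⊛ (λ n k → + g n k)) n k
                                  ≡ + ∑ n (λ i → ∑ k (λ j → f i j * g (n ∸ i) (k ∸ j)))
pos-⊛ f g n k = ≡.trans (sumTo-cong n (λ i → ≡.trans (sumTo-cong k (λ j → ≡.sym (ℤ.pos-* (f i j) _))) (pos-sumTo k _)))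
                        (pos-sumTo n _)

Aser : PS
Aser n k = + c′ n k

Cser≈1+XA : ∀ n k → Cser n k ≡ (constPS (+ 1) ⊕ X ⊛ Aser) n k
Cser≈1+XA zero    k = ≡.sym (≡.trans (cong (ℤ._+_ (constPS (+ 1) 0 k)) (X-⊛-zero Aser k)) (empty-word k))
  where
  empty-word : ∀ k → constPS (+ 1) 0 k ℤ.+ + 0 ≡ Cser 0 k
  empty-word zero    = refl
  empty-word (suc k) = refl
Cser≈1+XA (suc n) k = ≡.trans (cong +_ (c-suc n k)) (≡.sym (≡.trans (ℤ.+-identityˡ _) (X-⊛-suc Aser n k)))

cross-coefficient : ∀ m k → (Y ⊛ (X ⊛ (Aser ⊛ Aser))) m k ≡ + cross m k
cross-coefficient zero    zero    = Y-⊛-zero (X ⊛ (Aser ⊛ Aser)) 0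
cross-coefficient zero    (suc k) = ≡.trans (Y-⊛-suc (X ⊛ (Aser ⊛ Aser)) 0 k) (X-⊛-zero (Aser ⊛ Aser) k)
cross-coefficient (suc m) zero    = Y-⊛-zero (X ⊛ (Aser ⊛ Aser)) (suc m)
cross-coefficient (suc m) (suc k) =
  ≡.trans (Y-⊛-suc (X ⊛ (Aser ⊛ Aser)) (suc m) k) (≡.trans (X-⊛-suc (Aser ⊛ Aser) m k) (pos-⊛ c′ c′ m k))

Aser≈ΦA : ∀ n k → Aser n k ≡ Φ X Y Aser n k
Aser≈ΦA zero    k = ≡.sym (≡.trans (cong₂ ℤ._+_ (cong₂ ℤ._+_ (cong (ℤ._+_ (constPS (+ 1) 0 k)) (X-⊛-zero Aser k))
                                                          (X-⊛-zero Aser k))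
                                             (X-⊛-zero (Y ⊛ (X ⊛ (Aser ⊛ Aser))) k))
                                   (single-letter k))
  where
  single-letter : ∀ k → constPS (+ 1) 0 k ℤ.+ + 0 ℤ.+ + 0 ℤ.+ + 0 ≡ Aser 0 k
  single-letter zero    = refl
  single-letter (suc k) = refl
Aser≈ΦA (suc m) k = begin
  + c′ (suc m) k
    ≡⟨ cong +_ (c′-suc m k) ⟩
  + (c′ m k + c′ m k + cross m k)
    ≡⟨ ≡.trans (ℤ.pos-+ (c′ m k + c′ m k) (cross m k)) (cong (ℤ._+ + cross m k) (ℤ.pos-+ (c′ m k) (c′ m k))) ⟩
  Aser m k ℤ.+ Aser m k ℤ.+ + cross m k
    ≡⟨ cong₂ ℤ._+_ (cong (ℤ._+ Aser m k) (ℤ.+-identityˡ (Aser m k))) (cross-coefficient m k) ⟨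
  + 0 ℤ.+ Aser m k ℤ.+ Aser m k ℤ.+ (Y ⊛ (X ⊛ (Aser ⊛ Aser))) m k
    ≡⟨ cong₂ ℤ._+_ (cong₂ ℤ._+_ (cong (ℤ._+_ (+ 0)) (X-⊛-suc Aser m k)) (X-⊛-suc Aser m k))
                   (X-⊛-suc (Y ⊛ (X ⊛ (Aser ⊛ Aser))) m k) ⟨
  Φ X Y Aser (suc m) k ∎
  where open ≡-Reasoning

theorem1 : ∃[ S ] (IsSqrtDisc S × (∀ (n k : ℕ) → (constPS (+ 2) ⊛ X ⊛ Y ⊛ Cser) n k ≡ (Anum ⊖ S) n k))
theorem1 = rootΔ X Y Cser
         , (rootΔ-squared X Y Aser Cser Cser≈1+XA Aser≈ΦA , refl)
         , t≈u⊖[u⊖t] Anum (constPS (+ 2) ⊛ X ⊛ Y ⊛ Cser)
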